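{- Let $\alpha$ be a partition with all parts $\ge2$, let $\pi$ be a permutation of $\{1,\dots,\ell(\alpha)\}$, let $\alpha_\pi$ be the corresponding rearrangement of the entries of $\alpha$, and let $R_{\alpha_\pi}$ be the connected ribbon with overlapping partition $p^\pi$. Let $\nu\in[\alpha,(|\alpha|-\ell(\alpha)+1,\ell(\alpha)-1)]$. If $c^\nu_{R_{\alpha_\pi}}>0$, then $$\nu_i\le\sum_{q=i}^{\ell(\alpha)}\alpha_q-p^\pi_i\quad\text{for }1\le i\le\ell(p^\pi).$$
   Context: A ribbon is a skew Young diagram (English convention) with no $2\times2$ square. For a composition $\beta$ with parts $\ge2$, the connected ribbon $R_\beta$ has rows from top to bottom of lengths $\beta_1,\dots,\beta_{\ell(\beta)}$, each pair of consecutive rows sharing exactly one column. Rows are ranked by length, ties being broken so that a lower row counts as smaller. The overlapping partition $p=(p_1,\dots,p_{\ell(\beta)-1},0)$ of $R_\beta$ has $p_i$ equal to the number of columns of length two both of whose boxes lie among the $\ell(\beta)-i+1$ smallest rows; $\ell(p)$ is its number of nonzero parts. For a skew shape $A$, $s_A=\sum_\nu c^\nu_As_\nu$ (Littlewood–Richardson coefficients). $[\lambda,\mu]$ is the interval in dominance order. -}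

module Defs where

open import Data.Nat using (ℕ; zero; suc; _+_; _∸_; _≤_; _<_; _≥_; _<ᵇ_; _≡ᵇ_)
open import Data.Bool using (Bool; true; false; _∧_; _∨_; if_then_else_)
open import Data.List using (List; []; _∷_; length; take; drop; map; reverse; concat; tabulate; lookup; upTo)
open import Data.Nat.ListAction using (sum)
open import Data.List.Relation.Unary.All using (All)
open import Data.List.Relation.Unary.Linked using (Linked)
open import Data.Fin.Permutation using (Permutation′; _⟨$⟩ʳ_)
open import Data.Product using (_×_; Σ)
open import Relation.Binary.PropositionalEquality using (_≡_)

-- 1-based entry of a list, with value 0 outside the range 1..length
entry : List ℕ → ℕ → ℕ
entry []       _             = 0
entry (x ∷ xs) zero          = 0
entry (x ∷ xs) (suc zero)    = x
entry (x ∷ xs) (suc (suc n)) = entry xs (suc n)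

count : (ℕ → Bool) → List ℕ → ℕ
count f []       = 0
count f (x ∷ xs) = if f x then suc (count f xs) else count f xs

oneTo : ℕ → List ℕ
oneTo k = map suc (upTo k)

IsPartition : List ℕ → Set
IsPartition λ′ = Linked _≥_ λ′ × All (1 ≤_) λ′

_⊴_ : List ℕ → List ℕ → Set
μ ⊴ λ′ = (sum μ ≡ sum λ′) × (∀ k → sum (take k μ) ≤ sum (take k λ′))

InInterval : List ℕ → List ℕ → List ℕ → Set
InInterval ν λ′ μ = (λ′ ⊴ ν) × (ν ⊴ μ)

hookTop : List ℕ → List ℕ
hookTop α = (sum α ∸ length α + 1) ∷ (length α ∸ 1) ∷ []

rearrange : (α : List ℕ) → Permutation′ (length α) → List ℕ
rearrange α π = tabulate (λ i → lookup α (π ⟨$⟩ʳ i))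

-- Overlapping partition of the connected ribbon R_β (rows 1..ℓ(β), top to bottom)

smallerRow : List ℕ → ℕ → ℕ → Bool
smallerRow β s r = (entry β s <ᵇ entry β r) ∨ ((entry β s ≡ᵇ entry β r) ∧ (r <ᵇ s))

rowRank : List ℕ → ℕ → ℕ
rowRank β r = count (λ s → smallerRow β s r) (oneTo (length β))

inSmallest : List ℕ → ℕ → ℕ → Bool
inSmallest β i r = rowRank β r <ᵇ (length β ∸ i + 1)

-- p_i : number of columns of length two (between rows j and j+1, j = 1..ℓ-1)
-- with both boxes in the ℓ(β) - i + 1 smallest rows
overlapPart : List ℕ → ℕ → ℕ
overlapPart β i = count (λ j → inSmallest β i j ∧ inSmallest β i (suc j)) (oneTo (length β ∸ 1))

overlapping : List ℕ → List ℕ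
overlapping β = map (overlapPart β) (oneTo (length β ∸ 1)) Data.List.++ (0 ∷ [])

numNonzero : List ℕ → ℕ
numNonzero = count (λ x → 0 <ᵇ x)

-- Littlewood–Richardson tableaux of the ribbon R_β
-- A filling of R_β is given by its rows (top to bottom), each read left to right.
-- In English convention, the leftmost box of row j lies directly above the
-- rightmost box of row j+1.

hd : List ℕ → ℕ
hd []      = 0
hd (x ∷ _) = x

lst : List ℕ → ℕ
lst []           = 0
lst (x ∷ [])     = x
lst (_ ∷ y ∷ ys) = lst (y ∷ ys)

ColStrict : List ℕ → List ℕ → Set
ColStrict upper lower = hd upper < lst lower

readingWord : List (List ℕ) → List ℕ
readingWord rows = concat (map reverse rows)

record LRTableau (β ν : List ℕ) : Set where
  field
    rows       : List (List ℕ)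
    shape      : map length rows ≡ β
    positive   : All (All (1 ≤_)) rows
    rowWeak    : All (Linked _≤_) rows
    colStrict  : Linked ColStrict rows
    content    : ∀ j → 1 ≤ j → count (λ x → x ≡ᵇ j) (readingWord rows) ≡ entry ν j
    lattice    : ∀ n j → 1 ≤ j →
                 count (λ x → x ≡ᵇ suc j) (take n (readingWord rows))
                   ≤ count (λ x → x ≡ᵇ j) (take n (readingWord rows))

-- c^ν_{R_β} > 0  (by the Littlewood–Richardson rule: some LR tableau exists)
LRCoeffPositive : List ℕ → List ℕ → Set
LRCoeffPositive β ν = LRTableau β ν

-- Let S consist of the ℓ − i + 1 smallest rows of the ribbon, so that at most i − 1 rows are
-- unselected, and fix an LR tableau of content ν. Read the rows from top to bottom and give each
-- row the letter 1 + (number of unselected rows above it). Passing an unselected row turns a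
-- bound on the letters v read so far into the same bound on the letters v + 1: split the weakly
-- increasing row at v + 1 and apply the lattice property where the split is read. With the
-- monotonicity of lattice words this bounds ν_i by the number of entries of the selected rows
-- equal to their row's letter. In a row of length ≥ 2 these entries number at most the length
-- minus the number of the row's two ends that differ from its letter, and column strictness makes
-- one of the touching ends of two consecutive selected rows differ; hence ν_i + p_i ≤ Σ_{r ∈ S} β_r.
-- Finally the ℓ − i + 1 smallest rows are in total no longer than any other ℓ − i + 1 rows, in
-- particular than α_i, …, α_ℓ.

module Submission where

open import Defs

open import Data.Bool using (Bool; true; false; T; T?; not; _∧_; _∨_; if_then_else_)
open import Data.Bool.Properties using (T-∨; T-∧; T-≡)
open import Data.Empty using (⊥-elim)
open import Data.Fin using (Fin; zero; suc; toℕ)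
open import Data.Fin.Permutation using (Permutation′; _⟨$⟩ʳ_)
open import Data.Fin.Properties using (toℕ<n)
open import Data.List
  using (List; []; _∷_; [_]; _++_; length; map; reverse; upTo; applyUpTo; take; drop; tabulate; lookup)
open import Data.List.Membership.Propositional using (_∈_)
open import Data.List.Membership.Propositional.Properties using (∈-map⁺; ∈-upTo⁺; ∈-lookup)
open import Data.List.Properties
  using ( unfold-reverse; reverse-++; ++-assoc; ++-identityʳ; map-∘; map-upTo
        ; length-map; length-upTo; length-tabulate; length-applyUpTo)
open import Data.List.Relation.Unary.All as All using (All; []; _∷_)
open import Data.List.Relation.Unary.All.Properties using (map⁻; tabulate⁺)
open import Data.List.Relation.Unary.AllPairs using ([]; _∷_)
open import Data.List.Relation.Unary.Any using (here; there)
open import Data.List.Relation.Unary.Linked as Linked using (Linked; []; _∷_)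
open import Data.List.Relation.Unary.Linked.Properties using (Linked⇒All)
open import Data.List.Relation.Unary.Unique.Propositional using (Unique)
import Data.List.Relation.Unary.Unique.Propositional.Properties as Unique
open import Data.Nat
  using (ℕ; zero; suc; _+_; _*_; _∸_; _⊔_; _⊓_; _≤_; _<_; _<ᵇ_; _≡ᵇ_; _≤ᵇ_; z≤n; s≤s)
open import Data.Nat.ListAction using (sum)
open import Data.Nat.Properties
open import Algebra.Properties.Semiring.Sum +-*-semiring
  using (sum-syntax; ∑-distrib-+; *-distribʳ-sum; sum-cong-≗; sum-permute)
open import Data.Nat.Tactic.RingSolver using (solve-∀)
open import Data.Product as Product using (_×_; _,_; proj₂; ∃; ∃₂)
open import Data.Sum as Sum using (_⊎_; inj₁; inj₂)
open import Data.Unit using (tt)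
open import Function using (_∘_; Equivalence)
open import Relation.Binary.Definitions using (tri<; tri≈; tri>)
open import Relation.Binary.PropositionalEquality
  using (_≡_; _≢_; refl; sym; trans; cong; cong₂; subst; subst₂; module ≡-Reasoning)
open import Relation.Nullary using (¬_; yes; no)
open import Relation.Nullary.Decidable using (decidable-stable)

count-++ : ∀ f (xs ys : List ℕ) → count f (xs ++ ys) ≡ count f xs + count f ys
count-++ f []       ys = refl
count-++ f (x ∷ xs) ys with f x
... | true  = cong suc (count-++ f xs ys)
... | false = count-++ f xs ys

count-reverse : ∀ f (xs : List ℕ) → count f (reverse xs) ≡ count f xs
count-reverse f []       = refl
count-reverse f (x ∷ xs) = begin
  count f (reverse (x ∷ xs))            ≡⟨ cong (count f) (unfold-reverse x xs) ⟩
  count f (reverse xs ++ [ x ])         ≡⟨ count-++ f (reverse xs) [ x ] ⟩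
  count f (reverse xs) + count f [ x ]  ≡⟨ cong (_+ count f [ x ]) (count-reverse f xs) ⟩
  count f xs + count f [ x ]            ≡⟨ +-comm (count f xs) _ ⟩
  count f [ x ] + count f xs            ≡⟨ count-++ f [ x ] xs ⟨
  count f (x ∷ xs)                      ∎
  where open ≡-Reasoning

count-map : ∀ f g (xs : List ℕ) → count f (map g xs) ≡ count (f ∘ g) xs
count-map f g []       = refl
count-map f g (x ∷ xs) = cong (λ c → if f (g x) then suc c else c) (count-map f g xs)

count-upTo-suc : ∀ f n → count f (upTo (suc n)) ≡ (if f 0 then suc (count (f ∘ suc) (upTo n))
                                                          else count (f ∘ suc) (upTo n))
count-upTo-suc f n = cong (λ c → if f 0 then suc c else c)
                          (trans (cong (count f) (sym (map-upTo suc n))) (count-map f suc (upTo n)))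

count-true : ∀ (xs : List ℕ) → count (λ _ → true) xs ≡ length xs
count-true []       = refl
count-true (x ∷ xs) = cong suc (count-true xs)

count-mono : ∀ {f g} → (∀ x → T (f x) → T (g x)) → ∀ xs → count f xs ≤ count g xs
count-mono         f⇒g []       = z≤n
count-mono {f} {g} f⇒g (x ∷ xs) with f x | g x | f⇒g x
... | true  | true  | _   = s≤s (count-mono f⇒g xs)
... | true  | false | fx⇒ = ⊥-elim (fx⇒ tt)
... | false | true  | _   = m≤n⇒m≤1+n (count-mono f⇒g xs)
... | false | false | _   = count-mono f⇒g xs

count≤length : ∀ f xs → count f xs ≤ length xs
count≤length f xs = ≤-trans (count-mono (λ _ _ → tt) xs) (≤-reflexive (count-true xs))

count-strict : ∀ {f g} → (∀ x → T (f x) → T (g x)) →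
               ∀ {y xs} → y ∈ xs → ¬ T (f y) → T (g y) → count f xs < count g xs
count-strict {f} {g} f⇒g {y} {_ ∷ xs} (here refl) ¬fy gy with f y | g y
... | true  | _     = ⊥-elim (¬fy tt)
... | false | true  = s≤s (count-mono f⇒g xs)
... | false | false = ⊥-elim gy
count-strict {f} {g} f⇒g {xs = x ∷ xs} (there y∈xs) ¬fy gy with f x | g x | f⇒g x
... | true  | true  | _   = s≤s (count-strict f⇒g y∈xs ¬fy gy)
... | true  | false | fx⇒ = ⊥-elim (fx⇒ tt)
... | false | true  | _   = m≤n⇒m≤1+n (count-strict f⇒g y∈xs ¬fy gy)
... | false | false | _   = count-strict f⇒g y∈xs ¬fy gy

count-∨ : ∀ f g xs → count (λ x → f x ∨ g x) xs ≤ count f xs + count g xs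
count-∨ f g []       = z≤n
count-∨ f g (x ∷ xs) with f x | g x
... | true  | true  = s≤s (≤-trans (count-∨ f g xs) (+-monoʳ-≤ (count f xs) (n≤1+n _)))
... | true  | false = s≤s (count-∨ f g xs)
... | false | true  = ≤-trans (s≤s (count-∨ f g xs)) (≤-reflexive (sym (+-suc _ _)))
... | false | false = count-∨ f g xs

count+count-not : ∀ f xs → count f xs + count (not ∘ f) xs ≡ length xs
count+count-not f []       = refl
count+count-not f (x ∷ xs) with f x
... | true  = cong suc (count+count-not f xs)
... | false = trans (+-suc _ _) (cong suc (count+count-not f xs))

count-all : ∀ {f xs} → All (T ∘ f) xs → count f xs ≡ length xs
count-all                []         = refl
count-all {f} {x ∷ xs} (fx ∷ fxs) with f x
... | true  = cong suc (count-all fxs)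
... | false = ⊥-elim fx

count-none : ∀ {f xs} → All (¬_ ∘ T ∘ f) xs → count f xs ≡ 0
count-none []                       = refl
count-none {f} {x ∷ xs} (¬fx ∷ ¬fxs) with f x
... | true  = ⊥-elim (¬fx tt)
... | false = count-none ¬fxs

count-≡ᵇ-injective : ∀ (g : ℕ → ℕ) {xs} → Unique xs →
                     (∀ {x y} → x ∈ xs → y ∈ xs → g x ≡ g y → x ≡ y) →
                     ∀ k → count (λ x → g x ≡ᵇ k) xs ≤ 1
count-≡ᵇ-injective g []               g-inj k = z≤n
count-≡ᵇ-injective g {x ∷ xs} (x∉xs ∷ unique) g-inj k with g x ≡ᵇ k in gx≡ᵇk
... | false = count-≡ᵇ-injective g unique (λ x∈ y∈ → g-inj (there x∈) (there y∈)) k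
... | true  = s≤s (≤-reflexive (count-none (All.tabulate gy≢k)))
  where
  gy≢k : ∀ {y} → y ∈ xs → ¬ T (g y ≡ᵇ k)
  gy≢k {y} y∈xs gy≡k = All.lookup x∉xs y∈xs
    (g-inj (here refl) (there y∈xs)
      (trans (≡ᵇ⇒≡ (g x) k (Equivalence.from T-≡ gx≡ᵇk)) (sym (≡ᵇ⇒≡ (g y) k gy≡k))))

count-<ᵇ-+ : ∀ (g : ℕ → ℕ) xs → (∀ k → count (λ x → g x ≡ᵇ k) xs ≤ 1) →
             ∀ a k → count (λ x → g x <ᵇ a + k) xs ≤ count (λ x → g x <ᵇ a) xs + k
count-<ᵇ-+ g xs at-most-once a zero =
  subst (λ b → count (λ x → g x <ᵇ b) xs ≤ count (λ x → g x <ᵇ a) xs + 0)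
        (sym (+-identityʳ a)) (m≤m+n _ 0)
count-<ᵇ-+ g xs at-most-once a (suc k) = begin
  count (λ x → g x <ᵇ a + suc k) xs                        ≤⟨ count-mono below-or-at xs ⟩
  count (λ x → (g x <ᵇ a + k) ∨ (g x ≡ᵇ a + k)) xs          ≤⟨ count-∨ _ _ xs ⟩
  count (λ x → g x <ᵇ a + k) xs + count (λ x → g x ≡ᵇ a + k) xs
    ≤⟨ +-mono-≤ (count-<ᵇ-+ g xs at-most-once a k) (at-most-once (a + k)) ⟩
  count (λ x → g x <ᵇ a) xs + k + 1                        ≡⟨ +-assoc _ k 1 ⟩
  count (λ x → g x <ᵇ a) xs + (k + 1)                      ≡⟨ cong (_+_ _) (+-comm k 1) ⟩
  count (λ x → g x <ᵇ a) xs + suc k                        ∎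
  where
  open ≤-Reasoning
  below-or-at : ∀ x → T (g x <ᵇ a + suc k) → T ((g x <ᵇ a + k) ∨ (g x ≡ᵇ a + k))
  below-or-at x gx<a+1+k with m<1+n⇒m<n∨m≡n (subst (g x <_) (+-suc a k) (<ᵇ⇒< _ _ gx<a+1+k))
  ... | inj₁ gx<a+k = Equivalence.from T-∨ (inj₁ (<⇒<ᵇ gx<a+k))
  ... | inj₂ gx≡a+k = Equivalence.from T-∨ (inj₂ (≡⇒≡ᵇ _ _ gx≡a+k))

-- Ranking by a strict total order

module Ranking (_≺_ : ℕ → ℕ → Bool)
               (≺-irrefl : ∀ x → ¬ T (x ≺ x))
               (≺-trans : ∀ {x y z} → T (x ≺ y) → T (y ≺ z) → T (x ≺ z))
               (≺-total : ∀ {x y} → x ≢ y → T (x ≺ y) ⊎ T (y ≺ x))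
               {xs : List ℕ} (xs-unique : Unique xs) where

  rank : ℕ → ℕ
  rank y = count (_≺ y) xs

  rank-mono : ∀ {x y} → x ∈ xs → T (x ≺ y) → rank x < rank y
  rank-mono x∈xs x≺y = count-strict (λ _ z≺x → ≺-trans z≺x x≺y) x∈xs (≺-irrefl _) x≺y

  rank-injective : ∀ {x y} → x ∈ xs → y ∈ xs → rank x ≡ rank y → x ≡ y
  rank-injective x∈xs y∈xs rx≡ry = decidable-stable (_ ≟ _) λ x≢y →
    Sum.[ (λ x≺y → <-irrefl rx≡ry (rank-mono x∈xs x≺y))
    , (λ y≺x → <-irrefl (sym rx≡ry) (rank-mono y∈xs y≺x)) ] (≺-total x≢y)

  rank<length : ∀ {y} → y ∈ xs → rank y < length xs
  rank<length y∈xs =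
    ≤-trans (count-strict (λ _ _ → tt) y∈xs (≺-irrefl _) tt) (≤-reflexive (count-true xs))

  count-rank<ᵇ-+ : ∀ a k →
                   count (λ y → rank y <ᵇ a + k) xs ≤ count (λ y → rank y <ᵇ a) xs + k
  count-rank<ᵇ-+ = count-<ᵇ-+ rank xs (count-≡ᵇ-injective rank xs-unique rank-injective)

  count-rank<ᵇ-≤ : ∀ k → count (λ y → rank y <ᵇ k) xs ≤ k
  count-rank<ᵇ-≤ k = ≤-trans (count-rank<ᵇ-+ 0 k)
                              (≤-reflexive (cong (_+ k) (count-none (All.universal (λ _ ()) xs))))

  count-rank<ᵇ-≥ : ∀ {k} → k ≤ length xs → k ≤ count (λ y → rank y <ᵇ k) xs
  count-rank<ᵇ-≥ {k} k≤ℓ = +-cancelʳ-≤ (ℓ ∸ k) k _ (begin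
    k + (ℓ ∸ k)                             ≡⟨ m+[n∸m]≡n k≤ℓ ⟩
    ℓ                                       ≡⟨ count-all (All.tabulate (<⇒<ᵇ ∘ rank<length)) ⟨
    count (λ y → rank y <ᵇ ℓ) xs            ≡⟨ cong (λ b → count (λ y → rank y <ᵇ b) xs) (m+[n∸m]≡n k≤ℓ) ⟨
    count (λ y → rank y <ᵇ k + (ℓ ∸ k)) xs  ≤⟨ count-rank<ᵇ-+ k (ℓ ∸ k) ⟩
    count (λ y → rank y <ᵇ k) xs + (ℓ ∸ k)  ∎)
    where
    open ≤-Reasoning
    ℓ = length xs

  rank-separates : ∀ {x y k} → y ∈ xs → rank x < k → k ≤ rank y → ¬ T (y ≺ x)
  rank-separates y∈xs rx<k k≤ry y≺x =
    <-irrefl refl (<-trans (rank-mono y∈xs y≺x) (<-≤-trans rx<k k≤ry))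

-- Lattice words and LR tableaux of ribbons

occurrences : ℕ → List ℕ → ℕ
occurrences j = count (_≡ᵇ j)

occurrences-none : ∀ {j xs} → All (_≢ j) xs → occurrences j xs ≡ 0
occurrences-none = count-none ∘ All.map (λ x≢j → x≢j ∘ ≡ᵇ⇒≡ _ _)

IsLatticeWord : List ℕ → Set
IsLatticeWord w = ∀ n j → 1 ≤ j → occurrences (suc j) (take n w) ≤ occurrences j (take n w)

take-length-++ : ∀ {A : Set} (u v : List A) → take (length u) (u ++ v) ≡ u
take-length-++ []      v = refl
take-length-++ (x ∷ u) v = cong (x ∷_) (take-length-++ u v)

lattice-prefix : ∀ u {v} → IsLatticeWord (u ++ v) →
                 ∀ {j} → 1 ≤ j → occurrences (suc j) u ≤ occurrences j u
lattice-prefix u {v} L {j} 1≤j =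
  subst (λ w → occurrences (suc j) w ≤ occurrences j w) (take-length-++ u v) (L (length u) j 1≤j)

lattice-antitone : ∀ {w} → IsLatticeWord w →
                   ∀ a k → occurrences (suc a + k) w ≤ occurrences (suc a) w
lattice-antitone {w} L a zero    = ≤-reflexive (cong (λ b → occurrences (suc b) w) (+-identityʳ a))
lattice-antitone {w} L a (suc k) = begin
  occurrences (suc a + suc k) w    ≡⟨ cong (λ b → occurrences (suc b) w) (+-suc a k) ⟩
  occurrences (suc (suc a + k)) w
    ≤⟨ lattice-prefix w (subst IsLatticeWord (sym (++-identityʳ w)) L) (s≤s z≤n) ⟩
  occurrences (suc a + k) w        ≤⟨ lattice-antitone L a k ⟩
  occurrences (suc a) w            ∎
  where open ≤-Reasoning

lattice-assoc : ∀ u v {w} → IsLatticeWord (u ++ v ++ w) → IsLatticeWord ((u ++ v) ++ w)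
lattice-assoc u v = subst IsLatticeWord (sym (++-assoc u v _))

split-sorted : ∀ t {ρ} → Linked _≤_ ρ →
               ∃₂ λ ys zs → ρ ≡ ys ++ zs × All (_< t) ys × All (t ≤_) zs
split-sorted t {[]}    _ = [] , [] , refl , [] , []
split-sorted t {x ∷ ρ} sorted with t ≤? x
... | yes t≤x = [] , x ∷ ρ , refl , [] , Linked⇒All ≤-trans t≤x sorted
... | no  t≰x with split-sorted t (Linked.tail sorted)
...   | ys , zs , ρ≡ys++zs , ys<t , t≤zs =
  x ∷ ys , zs , cong (x ∷_) ρ≡ys++zs , ≰⇒> t≰x ∷ ys<t , t≤zs

occurrences-++-reverse : ∀ j u xs →
                         occurrences j (u ++ reverse xs) ≡ occurrences j u + occurrences j xs
occurrences-++-reverse j u xs =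
  trans (count-++ _ u (reverse xs)) (cong (occurrences j u +_) (count-reverse _ xs))

-- Split ρ at 2 + τ: the reading word meets the entries ≥ 2 + τ first, and none of them is 1 + τ.
lattice-row-shift : ∀ τ u {ρ rest} → Linked _≤_ ρ → IsLatticeWord (u ++ reverse ρ ++ rest) →
                    occurrences (2 + τ) (u ++ reverse ρ) ≤ occurrences (suc τ) u
lattice-row-shift τ u {rest = rest} sorted L with split-sorted (2 + τ) sorted
... | ys , zs , refl , ys<t , t≤zs = begin
  occ t (u ++ reverse (ys ++ zs))  ≡⟨ occurrences-++-reverse t u (ys ++ zs) ⟩
  occ t u + occ t (ys ++ zs)       ≡⟨ cong (occ t u +_) (count-++ _ ys zs) ⟩
  occ t u + (occ t ys + occ t zs)  ≡⟨ cong (λ c → occ t u + (c + occ t zs)) no-t-in-ys ⟩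
  occ t u + occ t zs               ≡⟨ occurrences-++-reverse t u zs ⟨
  occ t (u ++ reverse zs)          ≤⟨ lattice-prefix (u ++ reverse zs) L′ (s≤s z≤n) ⟩
  occ (suc τ) (u ++ reverse zs)    ≡⟨ occurrences-++-reverse (suc τ) u zs ⟩
  occ (suc τ) u + occ (suc τ) zs   ≡⟨ cong (occ (suc τ) u +_) no-τ+1-in-zs ⟩
  occ (suc τ) u + 0                ≡⟨ +-identityʳ _ ⟩
  occ (suc τ) u                    ∎
  where
  open ≤-Reasoning
  occ = occurrences
  t = 2 + τ
  no-t-in-ys : occ t ys ≡ 0
  no-t-in-ys = occurrences-none (All.map (λ y<t y≡t → <-irrefl y≡t y<t) ys<t)
  no-τ+1-in-zs : occ (suc τ) zs ≡ 0
  no-τ+1-in-zs = occurrences-none (All.map (λ t≤z z≡1+τ → <-irrefl (sym z≡1+τ) t≤z) t≤zs)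
  regroup : u ++ reverse (ys ++ zs) ++ rest ≡ (u ++ reverse zs) ++ reverse ys ++ rest
  regroup = trans (cong (λ r → u ++ r ++ rest) (reverse-++ ys zs))
                  (trans (cong (u ++_) (++-assoc (reverse zs) (reverse ys) rest))
                         (sym (++-assoc u (reverse zs) _)))
  L′ : IsLatticeWord ((u ++ reverse zs) ++ reverse ys ++ rest)
  L′ = subst IsLatticeWord regroup L

-- A row selection S is a predicate on 0-based row indices, shifted (S ∘ suc) as rows are
-- consumed; τ counts the unselected rows already passed.
skipped : (ℕ → Bool) → List (List ℕ) → ℕ
skipped S []       = 0
skipped S (_ ∷ ρs) = if S 0 then skipped (S ∘ suc) ρs else suc (skipped (S ∘ suc) ρs)

selectedOccurrences : (ℕ → Bool) → ℕ → List (List ℕ) → ℕ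
selectedOccurrences S τ []       = 0
selectedOccurrences S τ (ρ ∷ ρs) =
  if S 0 then occurrences (suc τ) ρ + selectedOccurrences (S ∘ suc) τ ρs
         else selectedOccurrences (S ∘ suc) (suc τ) ρs

occurrences≤selectedOccurrences :
  ∀ S τ u ρs → All (Linked _≤_) ρs → IsLatticeWord (u ++ readingWord ρs) →
  occurrences (suc (τ + skipped S ρs)) (u ++ readingWord ρs)
    ≤ occurrences (suc τ) u + selectedOccurrences S τ ρs
occurrences≤selectedOccurrences S τ u [] [] L =
  subst₂ (λ k w → occurrences (suc k) w ≤ occurrences (suc τ) u + 0)
         (sym (+-identityʳ τ)) (sym (++-identityʳ u)) (m≤m+n _ 0)
occurrences≤selectedOccurrences S τ u (ρ ∷ ρs) (sorted ∷ rows-sorted) L with S 0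
... | true  = begin
  occ (suc (τ + k)) (u ++ reverse ρ ++ w)      ≡⟨ cong (occ _) (++-assoc u (reverse ρ) w) ⟨
  occ (suc (τ + k)) ((u ++ reverse ρ) ++ w)    ≤⟨ occurrences≤selectedOccurrences _ τ _ ρs rows-sorted L′ ⟩
  occ (suc τ) (u ++ reverse ρ) + sel           ≡⟨ cong (_+ sel) (occurrences-++-reverse (suc τ) u ρ) ⟩
  occ (suc τ) u + occ (suc τ) ρ + sel          ≡⟨ +-assoc (occ (suc τ) u) _ _ ⟩
  occ (suc τ) u + (occ (suc τ) ρ + sel)        ∎
  where
  open ≤-Reasoning
  occ = occurrences
  w = readingWord ρs
  k = skipped (S ∘ suc) ρs
  sel = selectedOccurrences (S ∘ suc) τ ρs
  L′ = lattice-assoc u (reverse ρ) L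
... | false = begin
  occ (suc (τ + suc k)) (u ++ reverse ρ ++ w)
    ≡⟨ cong₂ occ (cong suc (+-suc τ k)) (sym (++-assoc u (reverse ρ) w)) ⟩
  occ (suc (suc τ + k)) ((u ++ reverse ρ) ++ w)
    ≤⟨ occurrences≤selectedOccurrences _ (suc τ) _ ρs rows-sorted L′ ⟩
  occ (2 + τ) (u ++ reverse ρ) + sel
    ≤⟨ +-monoˡ-≤ sel (lattice-row-shift τ u sorted L) ⟩
  occ (suc τ) u + sel
    ∎
  where
  open ≤-Reasoning
  occ = occurrences
  w = readingWord ρs
  k = skipped (S ∘ suc) ρs
  sel = selectedOccurrences (S ∘ suc) (suc τ) ρs
  L′ = lattice-assoc u (reverse ρ) L

mismatch : ℕ → ℕ → ℕ
mismatch v x = if x ≡ᵇ v then 0 else 1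

occurrences+mismatch-last : ∀ v x xs →
                            occurrences v (x ∷ xs) + mismatch v (lst (x ∷ xs)) ≤ length (x ∷ xs)
occurrences+mismatch-last v x [] with x ≡ᵇ v
... | true  = ≤-refl
... | false = ≤-refl
occurrences+mismatch-last v x (y ∷ xs) with x ≡ᵇ v
... | true  = s≤s (occurrences+mismatch-last v y xs)
... | false = m≤n⇒m≤1+n (occurrences+mismatch-last v y xs)

occurrences+mismatches : ∀ v ρ → 2 ≤ length ρ →
                         occurrences v ρ + mismatch v (hd ρ) + mismatch v (lst ρ) ≤ length ρ
occurrences+mismatches v (x ∷ []) (s≤s ())
occurrences+mismatches v (x ∷ y ∷ xs) _ with x ≡ᵇ v
... | true  = subst (λ o → o + mismatch v (lst (y ∷ xs)) ≤ length (x ∷ y ∷ xs))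
                    (sym (+-identityʳ _)) (s≤s (occurrences+mismatch-last v y xs))
... | false = subst (_≤ length (x ∷ y ∷ xs))
                    (cong (_+ mismatch v (lst (y ∷ xs))) (+-comm 1 (occurrences v (y ∷ xs))))
                    (s≤s (occurrences+mismatch-last v y xs))

mismatch-distinct : ∀ v {a b} → a < b → 1 ≤ mismatch v a + mismatch v b
mismatch-distinct v {a} {b} a<b with a ≡ᵇ v in a≡ᵇv | b ≡ᵇ v in b≡ᵇv
... | true  | true  = ⊥-elim (<-irrefl (trans (≡ᵇ⇒≡ a v (Equivalence.from T-≡ a≡ᵇv))
                                              (sym (≡ᵇ⇒≡ b v (Equivalence.from T-≡ b≡ᵇv)))) a<b)
... | true  | false = ≤-refl
... | false | _     = s≤s z≤n

selectedPairs : (ℕ → Bool) → List (List ℕ) → ℕ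
selectedPairs S (_ ∷ ρ′ ∷ ρs) = if S 0 ∧ S 1 then suc (selectedPairs (S ∘ suc) (ρ′ ∷ ρs))
                                             else selectedPairs (S ∘ suc) (ρ′ ∷ ρs)
selectedPairs S _             = 0

selectedSum : (ℕ → Bool) → List ℕ → ℕ
selectedSum S []       = 0
selectedSum S (x ∷ xs) = (if S 0 then x else 0) + selectedSum (S ∘ suc) xs

firstRowLastMismatch : (ℕ → Bool) → ℕ → List (List ℕ) → ℕ
firstRowLastMismatch S τ []      = 0
firstRowLastMismatch S τ (ρ ∷ _) = if S 0 then mismatch (suc τ) (lst ρ) else 0

pair≤mismatches : ∀ (b : Bool) p m q → (T b → 1 ≤ m + q) →
                  (if b then suc p else p) ≤ p + m + (if b then q else 0)
pair≤mismatches true  p m q 1≤m+q = begin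
  suc p        ≡⟨ +-comm 1 p ⟩
  p + 1        ≤⟨ +-monoʳ-≤ p (1≤m+q tt) ⟩
  p + (m + q)  ≡⟨ +-assoc p m q ⟨
  p + m + q    ∎
  where open ≤-Reasoning
pair≤mismatches false p m q _     = ≤-trans (m≤m+n p m) (m≤m+n _ 0)

+-regroup : ∀ a b c d e f → a + b + (c + d + e) + f ≡ a + d + f + (b + c + e)
+-regroup = solve-∀

-- Column strictness makes one of the touching ends of two consecutive selected rows differ from
-- their common letter; firstRowLastMismatch keeps the first row's end available for that pair.
occurrences+pairs≤selectedSum :
  ∀ S τ ρs → All ((2 ≤_) ∘ length) ρs → Linked ColStrict ρs →
  selectedOccurrences S τ ρs + selectedPairs S ρs + firstRowLastMismatch S τ ρs
    ≤ selectedSum S (map length ρs)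
occurrences+pairs≤selectedSum S τ [] _ _ = z≤n
occurrences+pairs≤selectedSum S τ (ρ ∷ []) (long ∷ []) _ with S 0
... | true  = begin
  o + 0 + 0 + ml   ≡⟨ cong (_+ ml) (trans (+-identityʳ _) (+-identityʳ o)) ⟩
  o + ml           ≤⟨ +-monoˡ-≤ ml (m≤m+n o (mismatch v (hd ρ))) ⟩
  o + _ + ml       ≤⟨ occurrences+mismatches v ρ long ⟩
  length ρ         ≡⟨ +-identityʳ _ ⟨
  length ρ + 0     ∎
  where
  open ≤-Reasoning
  v = suc τ
  o = occurrences v ρ
  ml = mismatch v (lst ρ)
... | false = z≤n
occurrences+pairs≤selectedSum S τ (ρ ∷ ρ′ ∷ ρs) (long ∷ longs) (col ∷ cols) with S 0
... | true  = begin
  o + sel′ + (if S 1 then suc p′ else p′) + ml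
    ≤⟨ +-monoˡ-≤ ml (+-monoʳ-≤ (o + sel′) (pair≤mismatches (S 1) p′ mh _ λ _ → mismatch-distinct v col)) ⟩
  o + sel′ + (p′ + mh + m′) + ml     ≡⟨ +-regroup o sel′ p′ mh m′ ml ⟩
  o + mh + ml + (sel′ + p′ + m′)     ≤⟨ +-mono-≤ (occurrences+mismatches v ρ long)
                                                 (occurrences+pairs≤selectedSum (S ∘ suc) τ (ρ′ ∷ ρs) longs cols) ⟩
  length ρ + selectedSum (S ∘ suc) (map length (ρ′ ∷ ρs)) ∎
  where
  open ≤-Reasoning
  v = suc τ
  o = occurrences v ρ
  mh = mismatch v (hd ρ)
  ml = mismatch v (lst ρ)
  sel′ = selectedOccurrences (S ∘ suc) τ (ρ′ ∷ ρs)
  p′ = selectedPairs (S ∘ suc) (ρ′ ∷ ρs)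
  m′ = firstRowLastMismatch (S ∘ suc) τ (ρ′ ∷ ρs)
... | false =
  ≤-trans (+-monoʳ-≤ _ z≤n) (occurrences+pairs≤selectedSum (S ∘ suc) (suc τ) (ρ′ ∷ ρs) longs cols)

entry+selectedPairs≤selectedSum :
  ∀ {β ν} (t : LRTableau β ν) S {i} → 1 ≤ i → skipped S (LRTableau.rows t) < i →
  All ((2 ≤_) ∘ length) (LRTableau.rows t) →
  entry ν i + selectedPairs S (LRTableau.rows t) ≤ selectedSum S β
entry+selectedPairs≤selectedSum {β} {ν} t S {i} 1≤i skipped<i long = begin
  entry ν i + p                               ≡⟨ cong (_+ p) (content i 1≤i) ⟨
  occurrences i w + p                         ≡⟨ cong (λ k → occurrences k w + p) (m+[n∸m]≡n skipped<i) ⟨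
  occurrences (suc m + (i ∸ suc m)) w + p     ≤⟨ +-monoˡ-≤ p (lattice-antitone lattice m (i ∸ suc m)) ⟩
  occurrences (suc m) w + p
    ≤⟨ +-monoˡ-≤ p (occurrences≤selectedOccurrences S 0 [] rows rowWeak lattice) ⟩
  selectedOccurrences S 0 rows + p            ≤⟨ m≤m+n _ _ ⟩
  selectedOccurrences S 0 rows + p + firstRowLastMismatch S 0 rows
                                              ≤⟨ occurrences+pairs≤selectedSum S 0 rows long colStrict ⟩
  selectedSum S (map length rows)             ≡⟨ cong (selectedSum S) shape ⟩
  selectedSum S β                             ∎
  where
  open ≤-Reasoning
  open LRTableau t
  w = readingWord rows
  m = skipped S rows
  p = selectedPairs S rows

skipped≡count : ∀ S ρs → skipped S ρs ≡ count (not ∘ S) (upTo (length ρs))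
skipped≡count S []       = refl
skipped≡count S (_ ∷ ρs) rewrite count-upTo-suc (not ∘ S) (length ρs) with S 0
... | true  = skipped≡count (S ∘ suc) ρs
... | false = cong suc (skipped≡count (S ∘ suc) ρs)

selectedPairs≡count : ∀ S ρs →
                      selectedPairs S ρs ≡ count (λ j → S j ∧ S (suc j)) (upTo (length ρs ∸ 1))
selectedPairs≡count S []            = refl
selectedPairs≡count S (_ ∷ [])      = refl
selectedPairs≡count S (_ ∷ ρ′ ∷ ρs) =
  trans (cong (λ c → if S 0 ∧ S 1 then suc c else c) (selectedPairs≡count (S ∘ suc) (ρ′ ∷ ρs)))
        (sym (count-upTo-suc _ (length ρs)))

∑-mono-≤ : ∀ {n} {f g : Fin n → ℕ} → (∀ j → f j ≤ g j) → ∑[ j < n ] f j ≤ ∑[ j < n ] g j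
∑-mono-≤ {zero}  f≤g = z≤n
∑-mono-≤ {suc n} f≤g = +-mono-≤ (f≤g zero) (∑-mono-≤ (f≤g ∘ suc))

∑⟨_⟩ : ∀ {n} → (Fin n → Bool) → (Fin n → ℕ) → ℕ
∑⟨_⟩ {n} S a = ∑[ j < n ] (if S j then a j else 0)

∣_∣ : ∀ {n} → (Fin n → Bool) → ℕ
∣ S ∣ = ∑⟨ S ⟩ (λ _ → 1)

Separated : ∀ {n} → (Fin n → Bool) → (Fin n → ℕ) → Set
Separated S a = ∀ j k → T (S j) → ¬ T (S k) → a j ≤ a k

separating-threshold : ∀ {n} (S : Fin n → Bool) a → Separated S a →
                       ∃ λ M → (∀ j → T (S j) → a j ≤ M) × (∀ k → ¬ T (S k) → M ≤ a k)
separating-threshold {zero}  S a sep = 0 , (λ ()) , (λ ())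
separating-threshold {suc n} S a sep
  with separating-threshold (S ∘ suc) (a ∘ suc) (λ j k → sep (suc j) (suc k)) | T? (S zero)
... | M , below , above | yes S₀ =
  a zero ⊔ M
  , (λ { zero _ → m≤m⊔n (a zero) M ; (suc j) Sj → ≤-trans (below j Sj) (m≤n⊔m (a zero) M) })
  , (λ { zero ¬S₀ → ⊥-elim (¬S₀ S₀) ; (suc k) ¬Sk → ⊔-lub (sep zero (suc k) S₀ ¬Sk) (above k ¬Sk) })
... | M , below , above | no ¬S₀ =
  a zero ⊓ M
  , (λ { zero S₀ → ⊥-elim (¬S₀ S₀) ; (suc j) Sj → ⊓-glb (sep (suc j) zero Sj ¬S₀) (below j Sj) })
  , (λ { zero _ → m⊓n≤m (a zero) M ; (suc k) ¬Sk → ≤-trans (m⊓n≤n (a zero) M) (above k ¬Sk) })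

-- Exchange argument: for a threshold M between selected and unselected values,
-- [S] a + [P] M ≤ [P] a + [S] M holds pointwise.
∑⟨⟩-separated≤ : ∀ {n} (S P : Fin n → Bool) a → Separated S a → ∣ S ∣ ≤ ∣ P ∣ → ∑⟨ S ⟩ a ≤ ∑⟨ P ⟩ a
∑⟨⟩-separated≤ {n} S P a sep ∣S∣≤∣P∣ with separating-threshold S a sep
... | M , below , above = +-cancelʳ-≤ (∣ P ∣ * M) _ _ (begin
  ∑⟨ S ⟩ a + ∣ P ∣ * M
    ≡⟨ cong (∑⟨ S ⟩ a +_) (*-distribʳ-sum M (λ j → if P j then 1 else 0)) ⟩
  ∑⟨ S ⟩ a + ∑[ j < n ] ((if P j then 1 else 0) * M)
    ≡⟨ ∑-distrib-+ (λ j → if S j then a j else 0) (λ j → (if P j then 1 else 0) * M) ⟨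
  ∑[ j < n ] ((if S j then a j else 0) + (if P j then 1 else 0) * M)
    ≤⟨ ∑-mono-≤ swap ⟩
  ∑[ j < n ] ((if P j then a j else 0) + (if S j then 1 else 0) * M)
    ≡⟨ ∑-distrib-+ (λ j → if P j then a j else 0) (λ j → (if S j then 1 else 0) * M) ⟩
  ∑⟨ P ⟩ a + ∑[ j < n ] ((if S j then 1 else 0) * M)
    ≡⟨ cong (∑⟨ P ⟩ a +_) (*-distribʳ-sum M (λ j → if S j then 1 else 0)) ⟨
  ∑⟨ P ⟩ a + ∣ S ∣ * M
    ≤⟨ +-monoʳ-≤ (∑⟨ P ⟩ a) (*-monoˡ-≤ M ∣S∣≤∣P∣) ⟩
  ∑⟨ P ⟩ a + ∣ P ∣ * M ∎)
  where
  open ≤-Reasoning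
  swap : ∀ j → (if S j then a j else 0) + (if P j then 1 else 0) * M
             ≤ (if P j then a j else 0) + (if S j then 1 else 0) * M
  swap j with S j | P j | below j | above j
  ... | true  | true  | _      | _      = ≤-refl
  ... | true  | false | aj≤M   | _      = +-monoˡ-≤ 0 (aj≤M tt)
  ... | false | true  | _      | M≤aj   = +-monoˡ-≤ 0 (M≤aj (λ ()))
  ... | false | false | _      | _      = ≤-refl

selectedSum-tabulate : ∀ S {n} (a : Fin n → ℕ) → selectedSum S (tabulate a) ≡ ∑⟨ S ∘ toℕ ⟩ a
selectedSum-tabulate S {zero}  a = refl
selectedSum-tabulate S {suc n} a =
  cong ((if S 0 then a zero else 0) +_) (selectedSum-tabulate (S ∘ suc) (a ∘ suc))

count-upTo≡∣∣ : ∀ S n → count S (upTo n) ≡ ∣_∣ {n} (S ∘ toℕ)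
count-upTo≡∣∣ S zero    = refl
count-upTo≡∣∣ S (suc n) rewrite count-upTo-suc S n with S 0
... | true  = cong suc (count-upTo≡∣∣ (S ∘ suc) n)
... | false = count-upTo≡∣∣ (S ∘ suc) n

suc-≤ᵇ-suc : ∀ k t → (suc k ≤ᵇ suc t) ≡ (k ≤ᵇ t)
suc-≤ᵇ-suc zero    t = refl
suc-≤ᵇ-suc (suc k) t = refl

∑-suffix : ∀ (xs : List ℕ) k → ∑⟨ (λ q → k ≤ᵇ toℕ q) ⟩ (lookup xs) ≡ sum (drop k xs)
∑-suffix []       zero    = refl
∑-suffix []       (suc k) = refl
∑-suffix (x ∷ xs) zero    = cong (x +_) (∑-suffix xs zero)
∑-suffix (x ∷ xs) (suc k) =
  trans (sum-cong-≗ {length xs} λ q → cong (λ b → if b then lookup xs q else 0) (suc-≤ᵇ-suc k (toℕ q)))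
        (∑-suffix xs k)

∣suffix∣ : ∀ n k → ∣_∣ {n} (λ q → k ≤ᵇ toℕ q) ≡ n ∸ k
∣suffix∣ zero    zero    = refl
∣suffix∣ zero    (suc k) = refl
∣suffix∣ (suc n) zero    = cong suc (∣suffix∣ n zero)
∣suffix∣ (suc n) (suc k) =
  trans (sum-cong-≗ {n} λ q → cong (λ b → if b then 1 else 0) (suc-≤ᵇ-suc k (toℕ q))) (∣suffix∣ n k)

-- The smallest rows of a ribbon

module _ (β : List ℕ) where

  private
    RowLess : ℕ → ℕ → Set
    RowLess s r = entry β s < entry β r ⊎ (entry β s ≡ entry β r × r < s)

    smallerRow⇒ : ∀ {s r} → T (smallerRow β s r) → RowLess s r
    smallerRow⇒ = Sum.map (<ᵇ⇒< _ _) (Product.map (≡ᵇ⇒≡ _ _) (<ᵇ⇒< _ _) ∘ Equivalence.to T-∧)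
                ∘ Equivalence.to T-∨

    ⇒smallerRow : ∀ {s r} → RowLess s r → T (smallerRow β s r)
    ⇒smallerRow = Equivalence.from T-∨
                ∘ Sum.map <⇒<ᵇ (Equivalence.from T-∧ ∘ Product.map (≡⇒≡ᵇ _ _) <⇒<ᵇ)

  entry<⇒smallerRow : ∀ {s r} → entry β s < entry β r → T (smallerRow β s r)
  entry<⇒smallerRow = ⇒smallerRow ∘ inj₁

  smallerRow-irrefl : ∀ r → ¬ T (smallerRow β r r)
  smallerRow-irrefl r = Sum.[ <-irrefl refl , <-irrefl refl ∘ proj₂ ] ∘ smallerRow⇒

  smallerRow-trans : ∀ {s r q} →
                     T (smallerRow β s r) → T (smallerRow β r q) → T (smallerRow β s q)
  smallerRow-trans s≺r r≺q = ⇒smallerRow (lex (smallerRow⇒ s≺r) (smallerRow⇒ r≺q))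
    where
    lex : ∀ {s r q} → RowLess s r → RowLess r q → RowLess s q
    lex (inj₁ s<r)          (inj₁ r<q)          = inj₁ (<-trans s<r r<q)
    lex (inj₁ s<r)          (inj₂ (r≡q , _))    = inj₁ (subst (_ <_) r≡q s<r)
    lex (inj₂ (s≡r , _))    (inj₁ r<q)          = inj₁ (subst (_< _) (sym s≡r) r<q)
    lex (inj₂ (s≡r , r<s))  (inj₂ (r≡q , q<r))  = inj₂ (trans s≡r r≡q , <-trans q<r r<s)

  smallerRow-total : ∀ {s r} → s ≢ r → T (smallerRow β s r) ⊎ T (smallerRow β r s)
  smallerRow-total {s} {r} s≢r with <-cmp (entry β s) (entry β r) | <-cmp s r
  ... | tri< es<er _ _ | _              = inj₁ (⇒smallerRow (inj₁ es<er))
  ... | tri> _ _ er<es | _              = inj₂ (⇒smallerRow (inj₁ er<es))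
  ... | tri≈ _ es≡er _ | tri< s<r _ _   = inj₂ (⇒smallerRow (inj₂ (sym es≡er , s<r)))
  ... | tri≈ _ _ _     | tri≈ _ s≡r _   = ⊥-elim (s≢r s≡r)
  ... | tri≈ _ es≡er _ | tri> _ _ r<s   = inj₁ (⇒smallerRow (inj₂ (es≡er , r<s)))

oneTo-unique : ∀ n → Unique (oneTo n)
oneTo-unique n = Unique.map⁺ suc-injective (Unique.upTo⁺ n)

∈-oneTo : ∀ {n r} → r < n → suc r ∈ oneTo n
∈-oneTo r<n = ∈-map⁺ suc (∈-upTo⁺ r<n)

length-oneTo : ∀ n → length (oneTo n) ≡ n
length-oneTo n = trans (length-map suc (upTo n)) (length-upTo n)

m∸[1+n]+1≡m∸n : ∀ {ℓ i} → i < ℓ → ℓ ∸ suc i + 1 ≡ ℓ ∸ i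
m∸[1+n]+1≡m∸n {ℓ} {i} i<ℓ = trans (sym (+-∸-comm 1 i<ℓ)) (cong (_∸ suc i) (+-comm ℓ 1))

module SmallestRows (β : List ℕ) where

  open Ranking (smallerRow β) (smallerRow-irrefl β) (smallerRow-trans β) (smallerRow-total β)
               (oneTo-unique (length β))

  selected : ℕ → ℕ → Bool
  selected i j = inSmallest β (suc i) (suc j)

  ∣selected∣≤ : ∀ {i} → i < length β → ∣_∣ {length β} (selected i ∘ toℕ) ≤ length β ∸ i
  ∣selected∣≤ {i} i<ℓ = begin
    ∣_∣ {ℓ} (selected i ∘ toℕ)                    ≡⟨ count-upTo≡∣∣ (selected i) ℓ ⟨
    count (selected i) (upTo ℓ)                   ≡⟨ count-map (inSmallest β (suc i)) suc (upTo ℓ) ⟨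
    count (inSmallest β (suc i)) (oneTo ℓ)        ≤⟨ count-rank<ᵇ-≤ (ℓ ∸ suc i + 1) ⟩
    ℓ ∸ suc i + 1                                 ≡⟨ m∸[1+n]+1≡m∸n i<ℓ ⟩
    ℓ ∸ i                                         ∎
    where
    open ≤-Reasoning
    ℓ = length β

  count-not-smallest≤ : ∀ {i} → i < length β →
                        count (not ∘ inSmallest β (suc i)) (oneTo (length β)) ≤ i
  count-not-smallest≤ {i} i<ℓ = begin
    c′                   ≡⟨ m+n∸m≡n c c′ ⟨
    c + c′ ∸ c           ≡⟨ cong (_∸ c) (trans (count+count-not _ (oneTo ℓ)) (length-oneTo ℓ)) ⟩
    ℓ ∸ c                ≤⟨ ∸-monoʳ-≤ ℓ K≤c ⟩
    ℓ ∸ (ℓ ∸ suc i + 1)  ≡⟨ cong (ℓ ∸_) (m∸[1+n]+1≡m∸n i<ℓ) ⟩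
    ℓ ∸ (ℓ ∸ i)          ≡⟨ m∸[m∸n]≡n (<⇒≤ i<ℓ) ⟩
    i                    ∎
    where
    open ≤-Reasoning
    ℓ = length β
    c = count (inSmallest β (suc i)) (oneTo ℓ)
    c′ = count (not ∘ inSmallest β (suc i)) (oneTo ℓ)
    K≤c : ℓ ∸ suc i + 1 ≤ c
    K≤c = count-rank<ᵇ-≥ (subst₂ _≤_ (sym (m∸[1+n]+1≡m∸n i<ℓ)) (sym (length-oneTo ℓ)) (m∸n≤m ℓ i))

  skipped-selected≤ : ∀ {i} ρs → length ρs ≡ length β → i < length β → skipped (selected i) ρs ≤ i
  skipped-selected≤ {i} ρs ρs-length i<ℓ = begin
    skipped (selected i) ρs                        ≡⟨ skipped≡count (selected i) ρs ⟩
    count (not ∘ selected i) (upTo (length ρs))    ≡⟨ cong (count (not ∘ selected i) ∘ upTo) ρs-length ⟩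
    count (not ∘ selected i) (upTo (length β))     ≡⟨ count-map large suc (upTo (length β)) ⟨
    count large (oneTo (length β))                 ≤⟨ count-not-smallest≤ i<ℓ ⟩
    i                                              ∎
    where
    open ≤-Reasoning
    large = not ∘ inSmallest β (suc i)

  selectedPairs≡overlapPart : ∀ i ρs → length ρs ≡ length β →
                              selectedPairs (selected i) ρs ≡ overlapPart β (suc i)
  selectedPairs≡overlapPart i ρs ρs-length = begin
    selectedPairs (selected i) ρs
      ≡⟨ selectedPairs≡count (selected i) ρs ⟩
    count (adjacent ∘ suc) (upTo (length ρs ∸ 1))
      ≡⟨ cong (λ m → count (adjacent ∘ suc) (upTo (m ∸ 1))) ρs-length ⟩
    count (adjacent ∘ suc) (upTo (length β ∸ 1))
      ≡⟨ count-map adjacent suc (upTo (length β ∸ 1)) ⟨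
    overlapPart β (suc i)
      ∎
    where
    open ≡-Reasoning
    adjacent : ℕ → Bool
    adjacent j = inSmallest β (suc i) j ∧ inSmallest β (suc i) (suc j)

  smallest≤others : ∀ {i r r′} → T (inSmallest β i r) → ¬ T (inSmallest β i r′) →
                    r′ ∈ oneTo (length β) → entry β r ≤ entry β r′
  smallest≤others {i} r-small r′-large r′∈ = ≮⇒≥ λ e′<e →
    rank-separates {k = length β ∸ i + 1} r′∈ (<ᵇ⇒< _ _ r-small) (≮⇒≥ (r′-large ∘ <⇒<ᵇ))
                   (entry<⇒smallerRow β e′<e)

entry-tabulate : ∀ {n} (f : Fin n → ℕ) j → entry (tabulate f) (suc (toℕ j)) ≡ f j
entry-tabulate f zero    = refl
entry-tabulate f (suc j) = entry-tabulate (f ∘ suc) j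

smallest-rows-sum≤suffix-sum :
  ∀ α (π : Permutation′ (length α)) {i} → i < length (rearrange α π) →
  selectedSum (SmallestRows.selected (rearrange α π) i) (rearrange α π) ≤ sum (drop i α)
smallest-rows-sum≤suffix-sum α π {i} i<ℓ = begin
  selectedSum (selected i) β              ≡⟨ selectedSum-tabulate (selected i) a ⟩
  ∑⟨ S ⟩ a                                ≤⟨ ∑⟨⟩-separated≤ S P a separated ∣S∣≤∣P∣ ⟩
  ∑⟨ P ⟩ a                                ≡⟨ sum-permute (λ q → if i ≤ᵇ toℕ q then lookup α q else 0) π ⟨
  ∑⟨ (λ q → i ≤ᵇ toℕ q) ⟩ (lookup α)      ≡⟨ ∑-suffix α i ⟩
  sum (drop i α)                          ∎
  where
  open ≤-Reasoning
  open SmallestRows (rearrange α π)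
  n = length α
  a : Fin n → ℕ
  a j = lookup α (π ⟨$⟩ʳ j)
  β = rearrange α π
  ℓ≡n : length β ≡ n
  ℓ≡n = length-tabulate a
  S P : Fin n → Bool
  S = selected i ∘ toℕ
  P j = i ≤ᵇ toℕ (π ⟨$⟩ʳ j)
  separated : Separated S a
  separated j k Sj ¬Sk = subst₂ _≤_ (entry-tabulate a j) (entry-tabulate a k)
    (smallest≤others {suc i} Sj ¬Sk (∈-oneTo (subst (toℕ k <_) (sym ℓ≡n) (toℕ<n k))))

  ∣S∣≤∣P∣ : ∣ S ∣ ≤ ∣ P ∣
  ∣S∣≤∣P∣ = begin
    ∣ S ∣                       ≤⟨ subst (λ m → ∣_∣ {m} (selected i ∘ toℕ) ≤ m ∸ i) ℓ≡n (∣selected∣≤ i<ℓ) ⟩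
    n ∸ i                       ≡⟨ ∣suffix∣ n i ⟨
    ∣_∣ {n} (λ q → i ≤ᵇ toℕ q)  ≡⟨ sum-permute (λ q → if i ≤ᵇ toℕ q then 1 else 0) π ⟩
    ∣ P ∣                       ∎

overlapping-applyUpTo : ∀ β → overlapping β ≡ applyUpTo (overlapPart β ∘ suc) (length β ∸ 1) ++ [ 0 ]
overlapping-applyUpTo β =
  cong (_++ [ 0 ]) (trans (sym (map-∘ (upTo m))) (map-upTo (overlapPart β ∘ suc) m))
  where m = length β ∸ 1

entry-applyUpTo-++ : ∀ f m k → entry (applyUpTo f m ++ [ 0 ]) (suc k) ≤ f k
entry-applyUpTo-++ f zero    zero    = z≤n
entry-applyUpTo-++ f zero    (suc k) = z≤n
entry-applyUpTo-++ f (suc m) zero    = ≤-refl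
entry-applyUpTo-++ f (suc m) (suc k) = entry-applyUpTo-++ (f ∘ suc) m k

entry-overlapping≤overlapPart : ∀ β i → entry (overlapping β) (suc i) ≤ overlapPart β (suc i)
entry-overlapping≤overlapPart β i =
  subst (λ p → entry p (suc i) ≤ overlapPart β (suc i)) (sym (overlapping-applyUpTo β))
        (entry-applyUpTo-++ (overlapPart β ∘ suc) (length β ∸ 1) i)

numNonzero-overlapping≤ : ∀ β → numNonzero (overlapping β) ≤ length β ∸ 1
numNonzero-overlapping≤ β = begin
  numNonzero (overlapping β)          ≡⟨ cong numNonzero (overlapping-applyUpTo β) ⟩
  numNonzero (parts ++ [ 0 ])         ≡⟨ count-++ _ parts [ 0 ] ⟩
  numNonzero parts + 0                ≡⟨ +-identityʳ _ ⟩
  numNonzero parts                    ≤⟨ count≤length _ parts ⟩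
  length parts                        ≡⟨ length-applyUpTo _ (length β ∸ 1) ⟩
  length β ∸ 1                        ∎
  where
  open ≤-Reasoning
  parts = applyUpTo (overlapPart β ∘ suc) (length β ∸ 1)

All-rearrange : ∀ {P : ℕ → Set} {α} (π : Permutation′ (length α)) → All P α → All P (rearrange α π)
All-rearrange π pα = tabulate⁺ (λ j → All.lookup pα (∈-lookup (π ⟨$⟩ʳ j)))

theorem7p1 : (α : List ℕ) → IsPartition α → All (2 ≤_) α →
               (π : Permutation′ (length α)) →
               (ν : List ℕ) → IsPartition ν → InInterval ν α (hookTop α) →
               LRCoeffPositive (rearrange α π) ν →
               ∀ i → 1 ≤ i → i ≤ numNonzero (overlapping (rearrange α π)) →
               entry ν i + entry (overlapping (rearrange α π)) i ≤ sum (drop (i ∸ 1) α)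
theorem7p1 α _ parts≥2 π ν _ _ t (suc i) _ i<nz = begin
  entry ν (suc i) + entry (overlapping β) (suc i)
    ≤⟨ +-monoʳ-≤ (entry ν (suc i)) (entry-overlapping≤overlapPart β i) ⟩
  entry ν (suc i) + overlapPart β (suc i)
    ≡⟨ cong (entry ν (suc i) +_) (selectedPairs≡overlapPart i rows rows-length) ⟨
  entry ν (suc i) + selectedPairs (selected i) rows
    ≤⟨ entry+selectedPairs≤selectedSum t (selected i) (s≤s z≤n)
                                       (s≤s (skipped-selected≤ rows rows-length i<ℓ)) rows-long ⟩
  selectedSum (selected i) β
    ≤⟨ smallest-rows-sum≤suffix-sum α π i<ℓ ⟩
  sum (drop i α) ∎
  where
  open ≤-Reasoning
  open LRTableau t using (rows; shape)
  β = rearrange α π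
  open SmallestRows β
  rows-length : length rows ≡ length β
  rows-length = trans (sym (length-map length rows)) (cong length shape)
  rows-long : All ((2 ≤_) ∘ length) rows
  rows-long = map⁻ (subst (All (2 ≤_)) (sym shape) (All-rearrange π parts≥2))
  i<ℓ : i < length β
  i<ℓ = <-≤-trans i<nz (≤-trans (numNonzero-overlapping≤ β) (m∸n≤m (length β) 1))
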